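{- Let $\Gamma_1$ and $\Gamma_2$ be graphs, neither of which has an isolated vertex. Then the join $\Gamma_1\vee\Gamma_2$ admits a non-trivial chromatically invariant $2$-edge-colouring in which every vertex is incident with at least one red edge and at least one blue edge.
   Context: All graphs are finite, simple, with nonempty vertex set. The join $\Gamma_1\vee\Gamma_2$ is the disjoint union of $\Gamma_1$ and $\Gamma_2$ together with all edges between $V(\Gamma_1)$ and $V(\Gamma_2)$. A $2$-edge-colouring of a graph $\Gamma$ is a triple $G=(\Gamma,R,B)$ with $R,B\subseteq E(\Gamma)$, $R\cap B=\emptyset$, $R\cup B=E(\Gamma)$ (red and blue edges). A $k$-colouring of $G$ is a proper vertex colouring $c:V(\Gamma)\to\{1,\dots,k\}$ of $\Gamma$ such that for every $ux\in R$ and $vy\in B$ (either endpoint may play the role of $u$, resp. $v$), $c(u)=c(v)$ implies $c(x)\ne c(y)$. $P(G,\lambda)$ is the polynomial whose value at each non-negative integer $k$ is the number of $k$-colourings of $G$. $G$ is chromatically invariant if $P(G,\lambda)=P(\Gamma,\lambda)$ (the usual chromatic polynomial of $\Gamma$), and non-trivially chromatically invariant if moreover $R\ne\emptyset$ and $B\ne\emptyset$. -}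

module Defs where

open import Data.Nat using (ℕ; zero; suc; _+_)
open import Data.Fin using (Fin; splitAt; _≟_)
open import Data.Fin.Properties using ()
open import Data.Bool using (Bool; true; false; not; _∧_)
open import Data.List using (List; []; _∷_; [_]; map; concatMap; allFin)
open import Data.Vec using (Vec; []; _∷_; lookup)
open import Data.Sum using (_⊎_; inj₁; inj₂)
open import Data.Product using (Σ; ∃; _×_; _,_)
open import Relation.Binary.PropositionalEquality using (_≡_)
open import Relation.Nullary.Decidable using (⌊_⌋)
open import Relation.Nullary using (¬_)

record Graph (n : ℕ) : Set where
  field
    adj   : Fin n → Fin n → Bool
    sym   : ∀ u v → adj u v ≡ adj v u
    irrefl : ∀ v → adj v v ≡ false
open Graph public

NoIsolatedVertex : ∀ {n} → Graph n → Set
NoIsolatedVertex {n} Γ = ∀ (v : Fin n) → ∃ λ (u : Fin n) → adj Γ v u ≡ true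

-- Join Γ₁ ∨ Γ₂ on Fin (n₁ + n₂): the first n₁ vertices are Γ₁, the rest Γ₂.
joinAdj : ∀ {n₁ n₂} → Graph n₁ → Graph n₂ → Fin (n₁ + n₂) → Fin (n₁ + n₂) → Bool
joinAdj {n₁} Γ₁ Γ₂ u v with splitAt n₁ u | splitAt n₁ v
... | inj₁ a | inj₁ b = adj Γ₁ a b
... | inj₂ a | inj₂ b = adj Γ₂ a b
... | inj₁ _ | inj₂ _ = true
... | inj₂ _ | inj₁ _ = true

joinSym : ∀ {n₁ n₂} (Γ₁ : Graph n₁) (Γ₂ : Graph n₂) u v →
          joinAdj Γ₁ Γ₂ u v ≡ joinAdj Γ₁ Γ₂ v u
joinSym {n₁} Γ₁ Γ₂ u v with splitAt n₁ u | splitAt n₁ v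
... | inj₁ a | inj₁ b = sym Γ₁ a b
... | inj₂ a | inj₂ b = sym Γ₂ a b
... | inj₁ _ | inj₂ _ = _≡_.refl
... | inj₂ _ | inj₁ _ = _≡_.refl

joinIrrefl : ∀ {n₁ n₂} (Γ₁ : Graph n₁) (Γ₂ : Graph n₂) v →
             joinAdj Γ₁ Γ₂ v v ≡ false
joinIrrefl {n₁} Γ₁ Γ₂ v with splitAt n₁ v
... | inj₁ a = irrefl Γ₁ a
... | inj₂ a = irrefl Γ₂ a

join : ∀ {n₁ n₂} → Graph n₁ → Graph n₂ → Graph (n₁ + n₂)
join Γ₁ Γ₂ = record { adj = joinAdj Γ₁ Γ₂ ; sym = joinSym Γ₁ Γ₂ ; irrefl = joinIrrefl Γ₁ Γ₂ }

-- A 2-edge-colouring of Γ: every edge uv gets colour red (isRed u v ≡ true)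
-- or blue (isRed u v ≡ false); the colour of an unordered edge is
-- well defined (symmetry). Values on non-edges are irrelevant.
-- R and B are then automatically disjoint with union E(Γ).
record EdgeColouring {n : ℕ} (Γ : Graph n) : Set where
  field
    isRed  : Fin n → Fin n → Bool
    redSym : ∀ u v → isRed u v ≡ isRed v u
open EdgeColouring public

red? : ∀ {n} {Γ : Graph n} → EdgeColouring Γ → Fin n → Fin n → Bool
red? {Γ = Γ} G u v = adj Γ u v ∧ isRed G u v

blue? : ∀ {n} {Γ : Graph n} → EdgeColouring Γ → Fin n → Fin n → Bool
blue? {Γ = Γ} G u v = adj Γ u v ∧ not (isRed G u v)

Red : ∀ {n} {Γ : Graph n} → EdgeColouring Γ → Fin n → Fin n → Set
Red G u v = red? G u v ≡ true

Blue : ∀ {n} {Γ : Graph n} → EdgeColouring Γ → Fin n → Fin n → Set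
Blue G u v = blue? G u v ≡ true

allColourings : (n k : ℕ) → List (Vec (Fin k) n)
allColourings zero    k = [ [] ]
allColourings (suc n) k = concatMap (λ i → map (i ∷_) (allColourings n k)) (allFin k)

every : ∀ {A : Set} → (A → Bool) → List A → Bool
every p []       = true
every p (a ∷ as) = p a ∧ every p as

_==_ : ∀ {k} → Fin k → Fin k → Bool
a == b = ⌊ a ≟ b ⌋

proper? : ∀ {n k} → Graph n → Vec (Fin k) n → Bool
proper? {n} Γ c =
  every (λ u → every (λ v → not (adj Γ u v ∧ (lookup c u == lookup c v))) (allFin n)) (allFin n)

-- k-colouring of the 2-edge-coloured graph G: proper, and for every
-- (ordered, so either endpoint may play each role) red edge ux and blue
-- edge vy, c(u) = c(v) implies c(x) ≠ c(y).
colouring? : ∀ {n k} {Γ : Graph n} → EdgeColouring Γ → Vec (Fin k) n → Bool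
colouring? {n} {Γ = Γ} G c =
  proper? Γ c ∧
  every (λ u → every (λ x → every (λ v → every (λ y →
        not (red? G u x ∧ blue? G v y ∧ (lookup c u == lookup c v) ∧ (lookup c x == lookup c y)))
      (allFin n)) (allFin n)) (allFin n)) (allFin n)

count : ∀ {A : Set} → (A → Bool) → List A → ℕ
count p []       = 0
count p (a ∷ as) with p a
... | true  = suc (count p as)
... | false = count p as

P-graph : ∀ {n} → Graph n → ℕ → ℕ
P-graph {n} Γ k = count (proper? Γ) (allColourings n k)

P-edge : ∀ {n} {Γ : Graph n} → EdgeColouring Γ → ℕ → ℕ
P-edge {n} G k = count (colouring? G) (allColourings n k)

-- Chromatically invariant: P(G, λ) = P(Γ, λ) as polynomials, i.e. (polynomials
-- being determined by their values on ℕ) equal values at every k ∈ ℕ.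
ChromaticallyInvariant : ∀ {n} {Γ : Graph n} → EdgeColouring Γ → Set
ChromaticallyInvariant {Γ = Γ} G = ∀ (k : ℕ) → P-edge G k ≡ P-graph Γ k

NonTriviallyChromaticallyInvariant : ∀ {n} {Γ : Graph n} → EdgeColouring Γ → Set
NonTriviallyChromaticallyInvariant {n} G =
  ChromaticallyInvariant G
  × (∃ λ (u : Fin n) → ∃ λ (v : Fin n) → Red G u v)
  × (∃ λ (u : Fin n) → ∃ λ (v : Fin n) → Blue G u v)

module Submission where

-- Colour the edges of Γ₁ ∨ Γ₂ red when they lie inside Γ₁ or inside Γ₂ and
-- blue when they cross between the two sides.  This is an instance of a
-- general construction: for a graph Γ and a two-class partition s of its
-- vertices such that any two vertices in different classes are adjacent,
-- colour an edge red iff its ends lie in the same class.  Every proper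
-- colouring c of Γ is then a colouring of the edge-coloured graph: if ux is
-- red, vy is blue, c(u) = c(v) and c(x) = c(y), then u,v and x,y are
-- non-adjacent, hence in the same class, so v,y lie in the class of u,x,
-- contradicting that vy is blue.  So both polynomials count the same
-- colourings, i.e. the partition colouring is chromatically invariant.

open import Defs
open import Data.Nat using (ℕ; suc; _+_)
open import Data.Fin using (Fin; zero; splitAt; _↑ˡ_; _↑ʳ_)
open import Data.Fin.Properties using (splitAt-↑ˡ; splitAt-↑ʳ; splitAt⁻¹-↑ˡ; splitAt⁻¹-↑ʳ)
open import Data.Bool using (Bool; true; false; not; _∧_)
open import Data.Bool.Properties using (∧-conicalˡ; ∧-conicalʳ) renaming (_≟_ to _≟ᵇ_)
open import Data.Sum using (_⊎_; inj₁; inj₂)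
open import Data.Product using (Σ; ∃; _×_; _,_; proj₁; proj₂)
open import Data.List using ([]; _∷_; allFin)
open import Data.List.Membership.Propositional using (_∈_)
open import Data.List.Membership.Propositional.Properties using (∈-allFin)
open import Data.List.Relation.Unary.Any using (here; there)
open import Data.Vec using (Vec; lookup)
open import Data.Empty using (⊥; ⊥-elim)
open import Function.Bundles using (mk⇔)
open import Relation.Nullary using (does; yes; no)
open import Relation.Nullary.Decidable using (does-⇔)
open import Relation.Binary.PropositionalEquality
  using (_≡_; _≢_; refl; trans; cong; subst) renaming (sym to ≡-sym)

every-intro : ∀ {A : Set} (p : A → Bool) xs → (∀ a → p a ≡ true) → every p xs ≡ true
every-intro p []       h = refl
every-intro p (a ∷ xs) h rewrite h a = every-intro p xs h

every-elim : ∀ {A : Set} (p : A → Bool) {xs a} → every p xs ≡ true → a ∈ xs → p a ≡ true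
every-elim p {x ∷ _} e (here refl) = ∧-conicalˡ (p x) _ e
every-elim p {x ∷ _} e (there a∈) = every-elim p (∧-conicalʳ (p x) _ e) a∈

count-ext : ∀ {A : Set} {p q : A → Bool} xs → (∀ a → p a ≡ q a) → count p xs ≡ count q xs
count-ext []       h = refl
count-ext {p = p} {q} (a ∷ xs) h with p a | q a | h a
... | true  | true  | refl = cong suc (count-ext xs h)
... | false | false | refl = count-ext xs h

not-∧₄ : ∀ a b c d → (a ≡ true → b ≡ true → c ≡ true → d ≡ true → ⊥) →
         not (a ∧ b ∧ c ∧ d) ≡ true
not-∧₄ true  true  true  true  h = ⊥-elim (h refl refl refl refl)
not-∧₄ false _     _     _     h = refl
not-∧₄ true  false _     _     h = refl
not-∧₄ true  true  false _     h = refl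
not-∧₄ true  true  true  false h = refl

proper-nonAdjacent : ∀ {n k} (Γ : Graph n) (c : Vec (Fin k) n) → proper? Γ c ≡ true →
                     ∀ u v → (lookup c u == lookup c v) ≡ true → adj Γ u v ≡ false
proper-nonAdjacent Γ c pr u v same = nonEdge (adj Γ u v) noClash
  where
  noClash : not (adj Γ u v ∧ (lookup c u == lookup c v)) ≡ true
  noClash = every-elim _ (every-elim _ pr (∈-allFin u)) (∈-allFin v)

  nonEdge : ∀ a → not (a ∧ (lookup c u == lookup c v)) ≡ true → a ≡ false
  nonEdge false _ = refl
  nonEdge true  e with trans (cong (λ b → not (true ∧ b)) (≡-sym same)) e
  ... | ()

≟-sound : ∀ a b → does (a ≟ᵇ b) ≡ true → a ≡ b
≟-sound true  true  _ = refl
≟-sound false false _ = refl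

≟-complete : ∀ a b → not (does (a ≟ᵇ b)) ≡ true → a ≢ b
≟-complete true  true  () _
≟-complete false false () _
≟-complete true  false _  ()
≟-complete false true  _  ()

module Partition {n : ℕ} (Γ : Graph n) (s : Fin n → Bool) where

  partitionColouring : EdgeColouring Γ
  partitionColouring = record
    { isRed  = λ u v → does (s u ≟ᵇ s v)
    ; redSym = λ u v → does-⇔ (mk⇔ ≡-sym ≡-sym) (s u ≟ᵇ s v) (s v ≟ᵇ s u)
    }

  red-sameClass : ∀ u x → Red partitionColouring u x → s u ≡ s x
  red-sameClass u x r = ≟-sound (s u) (s x) (∧-conicalʳ (adj Γ u x) _ r)

  blue-differentClass : ∀ v y → Blue partitionColouring v y → s v ≢ s y
  blue-differentClass v y b = ≟-complete (s v) (s y) (∧-conicalʳ (adj Γ v y) _ b)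

  module _ (cross : ∀ u v → s u ≢ s v → adj Γ u v ≡ true) where

    nonAdjacent-sameClass : ∀ u v → adj Γ u v ≡ false → s u ≡ s v
    nonAdjacent-sameClass u v nonAdj with s u ≟ᵇ s v
    ... | yes eq = eq
    ... | no ne with trans (≡-sym (cross u v ne)) nonAdj
    ...   | ()

    noForbiddenPair : ∀ {k} (c : Vec (Fin k) n) → proper? Γ c ≡ true → ∀ u x v y →
      not (red? partitionColouring u x ∧ blue? partitionColouring v y
           ∧ (lookup c u == lookup c v) ∧ (lookup c x == lookup c y)) ≡ true
    noForbiddenPair c pr u x v y =
      not-∧₄ (red? partitionColouring u x) (blue? partitionColouring v y)
             (lookup c u == lookup c v) (lookup c x == lookup c y) λ red blue cu≡cv cx≡cy →
      let su≡sx = red-sameClass u x red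
          su≡sv = nonAdjacent-sameClass u v (proper-nonAdjacent Γ c pr u v cu≡cv)
          sx≡sy = nonAdjacent-sameClass x y (proper-nonAdjacent Γ c pr x y cx≡cy)
      in blue-differentClass v y blue (trans (≡-sym su≡sv) (trans su≡sx sx≡sy))

    colouring≡proper : ∀ {k} (c : Vec (Fin k) n) → colouring? partitionColouring c ≡ proper? Γ c
    colouring≡proper c with proper? Γ c in pr
    ... | false = refl
    ... | true  =
      every-intro _ (allFin n) λ u → every-intro _ (allFin n) λ x →
      every-intro _ (allFin n) λ v → every-intro _ (allFin n) λ y →
        noForbiddenPair c pr u x v y

    partition-invariant : ChromaticallyInvariant partitionColouring
    partition-invariant k = count-ext (allColourings n k) colouring≡proper

open Partition using (partitionColouring; partition-invariant)

module Join {n₁ n₂ : ℕ} (Γ₁ : Graph n₁) (Γ₂ : Graph n₂) where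

  inFirst : Fin n₁ ⊎ Fin n₂ → Bool
  inFirst (inj₁ _) = true
  inFirst (inj₂ _) = false

  side : Fin (n₁ + n₂) → Bool
  side u = inFirst (splitAt n₁ u)

  join-cross : ∀ u v → side u ≢ side v → joinAdj Γ₁ Γ₂ u v ≡ true
  join-cross u v ne with splitAt n₁ u | splitAt n₁ v
  ... | inj₁ _ | inj₂ _ = refl
  ... | inj₂ _ | inj₁ _ = refl
  ... | inj₁ _ | inj₁ _ = ⊥-elim (ne refl)
  ... | inj₂ _ | inj₂ _ = ⊥-elim (ne refl)

  joinColouring : EdgeColouring (join Γ₁ Γ₂)
  joinColouring = partitionColouring (join Γ₁ Γ₂) side

  joinColouring-invariant : ChromaticallyInvariant joinColouring
  joinColouring-invariant = partition-invariant (join Γ₁ Γ₂) side join-cross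

  data JoinVertex : Fin (n₁ + n₂) → Set where
    left  : (a : Fin n₁) → JoinVertex (a ↑ˡ n₂)
    right : (b : Fin n₂) → JoinVertex (n₁ ↑ʳ b)

  joinVertex : ∀ v → JoinVertex v
  joinVertex v with splitAt n₁ v in eq
  ... | inj₁ a = subst JoinVertex (splitAt⁻¹-↑ˡ eq) (left a)
  ... | inj₂ b = subst JoinVertex (splitAt⁻¹-↑ʳ eq) (right b)

  left-red : ∀ {a b} → adj Γ₁ a b ≡ true → Red joinColouring (a ↑ˡ n₂) (b ↑ˡ n₂)
  left-red {a} {b} e rewrite splitAt-↑ˡ n₁ a n₂ | splitAt-↑ˡ n₁ b n₂ | e = refl

  right-red : ∀ {a b} → adj Γ₂ a b ≡ true → Red joinColouring (n₁ ↑ʳ a) (n₁ ↑ʳ b)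
  right-red {a} {b} e rewrite splitAt-↑ʳ n₁ n₂ a | splitAt-↑ʳ n₁ n₂ b | e = refl

  left-blue : ∀ a b → Blue joinColouring (a ↑ˡ n₂) (n₁ ↑ʳ b)
  left-blue a b rewrite splitAt-↑ˡ n₁ a n₂ | splitAt-↑ʳ n₁ n₂ b = refl

  right-blue : ∀ b a → Blue joinColouring (n₁ ↑ʳ b) (a ↑ˡ n₂)
  right-blue b a rewrite splitAt-↑ʳ n₁ n₂ b | splitAt-↑ˡ n₁ a n₂ = refl

  redAndBlueAt : NoIsolatedVertex Γ₁ → NoIsolatedVertex Γ₂ → Fin n₁ → Fin n₂ →
    ∀ v → (∃ λ u → Red joinColouring v u) × (∃ λ u → Blue joinColouring v u)
  redAndBlueAt noIso₁ noIso₂ a₀ b₀ v with joinVertex v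
  ... | left a  = (proj₁ (noIso₁ a) ↑ˡ n₂ , left-red (proj₂ (noIso₁ a))) , (n₁ ↑ʳ b₀ , left-blue a b₀)
  ... | right b = (n₁ ↑ʳ proj₁ (noIso₂ b) , right-red (proj₂ (noIso₂ b))) , (a₀ ↑ˡ n₂ , right-blue b a₀)

open Join using (joinColouring; joinColouring-invariant; redAndBlueAt)

lemma10 : ∀ {n₁ n₂ : ℕ} (Γ₁ : Graph (suc n₁)) (Γ₂ : Graph (suc n₂)) →
    NoIsolatedVertex Γ₁ → NoIsolatedVertex Γ₂ →
    Σ (EdgeColouring (join Γ₁ Γ₂)) λ G →
      NonTriviallyChromaticallyInvariant G
      × (∀ (v : Fin (suc n₁ + suc n₂)) →
           (∃ λ (u : Fin (suc n₁ + suc n₂)) → Red G v u)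
           × (∃ λ (u : Fin (suc n₁ + suc n₂)) → Blue G v u))
lemma10 Γ₁ Γ₂ noIso₁ noIso₂ =
  G , (joinColouring-invariant Γ₁ Γ₂ , proj₁ atZero , proj₂ atZero) , redAndBlue
  where
  G : EdgeColouring (join Γ₁ Γ₂)
  G = joinColouring Γ₁ Γ₂

  -- Both sides are nonempty (they contain the vertex zero).
  redAndBlue : ∀ v → (∃ λ u → Red G v u) × (∃ λ u → Blue G v u)
  redAndBlue = redAndBlueAt Γ₁ Γ₂ noIso₁ noIso₂ zero zero

  atZero : (∃ λ v → ∃ λ u → Red G v u) × (∃ λ v → ∃ λ u → Blue G v u)
  atZero = (zero , proj₁ (redAndBlue zero)) , (zero , proj₂ (redAndBlue zero))
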